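{- Let $T\in SYT(\lambda)$ with $\lambda\vdash n$. For every $k=2,\dots,n$, the cell $(1,1)$ is below $\pi(T,k)$ if and only if $k-1\in\mathrm{Des}(\Psi_k(T))$.
   Context: Cells of a Ferrers diagram are indexed by (row, column) coordinates $(i,j)$, rows numbered from the bottom and columns from the left; cell $(i,j)$ is the unit square $[j-1,j]\times[i-1,i]$ with lower left-hand corner $(j-1,i-1)$. $SYT(\lambda)$ is the set of standard Young tableaux of shape $\lambda$ (entries $1,\dots,n$ increasing along rows and up columns); $c(i,j)$ is the content of cell $(i,j)$. For a standard Young tableau $S$, $\mathrm{Des}(S)=\{i : i+1 \text{ lies in a row strictly above the row containing } i\}$. Path $\pi(T,k)$: start at the lower left-hand corner of the cell containing $k$. At the lower left-hand corner of a cell $(i,j)$: if $i=1$ or $j=1$ go straight to the origin and stop; otherwise step South one unit if $c(i-1,j)>c(i,j-1)$ and West one unit if $c(i-1,j)<c(i,j-1)$; iterate. If $k$ is in cell $(r,s)$, for each $1\le i\le r-1$ the path crosses the line $y=i-\tfrac12$ at a single abscissa $x_i$; a cell $(i,j)$ with content less than $k$ is below $\pi(T,k)$ if $i\le r-1$ and $j-\tfrac12>x_i$, and above otherwise. Map $\Psi_k$: partition the cells with content less than $k$ into blocks of maximal length of cells with consecutive contents $a,\dots,a+m$ such that the cell containing $a$ is on the same side of $\pi(T,k)$ as $(1,1)$ and the cells containing $a+1,\dots,a+m$ are on the other side. In each block replace the content $a$ by $a+m$ and each content $a+l$ ($1\le l\le m$) by $a+l-1$; other cells unchanged. The result is $\Psi_k(T)$.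 -}

module Defs where

open import Data.Nat using (ℕ; zero; suc; _+_; _∸_; _≤_; _<_; _≥_; _<ᵇ_; _≡ᵇ_)
open import Data.Bool using (Bool; true; false; if_then_else_; _∧_)
open import Data.Product using (_×_; _,_; ∃-syntax; proj₁; proj₂)
open import Data.List using (List; []; _∷_; _++_; map; applyUpTo)
open import Data.Nat.ListAction using (sum)
open import Data.List.Relation.Unary.All using (All)
open import Data.List.Relation.Unary.Linked using (Linked)
open import Relation.Binary.PropositionalEquality using (_≡_)

-- Cells are pairs (i , j) = (row , column), 1-indexed, rows numbered from the bottom.
-- A partition is a list of row lengths (row 1 first), positive and weakly decreasing.
IsPartition : List ℕ → Set
IsPartition sh = All (λ l → 0 < l) sh × Linked _≥_ sh

rowLen : List ℕ → ℕ → ℕ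
rowLen []       _             = 0
rowLen (l ∷ ls) zero          = 0
rowLen (l ∷ ls) (suc zero)    = l
rowLen (l ∷ ls) (suc (suc i)) = rowLen ls (suc i)

InShape : List ℕ → ℕ → ℕ → Set
InShape sh i j = 1 ≤ i × 1 ≤ j × j ≤ rowLen sh i

cellsFrom : ℕ → List ℕ → List (ℕ × ℕ)
cellsFrom i []       = []
cellsFrom i (l ∷ ls) = applyUpTo (λ j → (i , suc j)) l ++ cellsFrom (suc i) ls

cells : List ℕ → List (ℕ × ℕ)
cells sh = cellsFrom 1 sh

Filling : Set
Filling = ℕ → ℕ → ℕ

-- Standard Young tableau of shape sh (n = sum sh): entries in 1..n, distinct
-- (hence a bijection onto 1..n), increasing along rows and up columns.
record IsSYT (sh : List ℕ) (T : Filling) : Set where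
  field
    range : ∀ i j → InShape sh i j → 1 ≤ T i j × T i j ≤ sum sh
    inj   : ∀ i j i' j' → InShape sh i j → InShape sh i' j' →
            T i j ≡ T i' j' → i ≡ i' × j ≡ j'
    rows  : ∀ i j → 1 ≤ j → InShape sh i (suc j) → T i j < T i (suc j)
    cols  : ∀ i j → 1 ≤ i → InShape sh (suc i) j → T i j < T (suc i) j

InDes : List ℕ → Filling → ℕ → Set
InDes sh S m = ∃[ i ] ∃[ j ] ∃[ i' ] ∃[ j' ]
  (InShape sh i j × InShape sh i' j' × S i j ≡ m × S i' j' ≡ suc m × i < i')

-- the cell containing value v (first found; unique for an SYT); (0,0) if none
cellOfIn : Filling → ℕ → List (ℕ × ℕ) → ℕ × ℕ
cellOfIn T v []              = (0 , 0)
cellOfIn T v ((i , j) ∷ cs) = if T i j ≡ᵇ v then (i , j) else cellOfIn T v cs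

cellOf : List ℕ → Filling → ℕ → ℕ × ℕ
cellOf sh T v = cellOfIn T v (cells sh)

-- The path π(T,k) as the list of lattice points (x , y) it visits, starting from
-- the lower left-hand corner (j-1 , i-1) of cell (i , j).  The fuel (i + j)
-- never runs out.  At cell (i,j) with i,j ≥ 2: go South (to cell (i-1,j)) if
-- c(i-1,j) > c(i,j-1), West (to cell (i,j-1)) if c(i-1,j) < c(i,j-1).
pathPts : Filling → ℕ → ℕ → ℕ → List (ℕ × ℕ)
pathPts T zero    i j = (j ∸ 1 , i ∸ 1) ∷ (0 , 0) ∷ []
pathPts T (suc f) (suc (suc i)) (suc (suc j)) =
  (suc j , suc i) ∷
    (if T (suc (suc i)) (suc j) <ᵇ T (suc i) (suc (suc j))
     then pathPts T f (suc i) (suc (suc j))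
     else pathPts T f (suc (suc i)) (suc j))
pathPts T (suc f) zero          j             = (j ∸ 1 , 0) ∷ (0 , 0) ∷ []
pathPts T (suc f) (suc zero)    j             = (j ∸ 1 , 0) ∷ (0 , 0) ∷ []
pathPts T (suc f) (suc (suc i)) zero          = (0 , suc i) ∷ (0 , 0) ∷ []
pathPts T (suc f) (suc (suc i)) (suc zero)    = (0 , suc i) ∷ (0 , 0) ∷ []

path : List ℕ → Filling → ℕ → List (ℕ × ℕ)
path sh T k with cellOf sh T k
... | (r , s) = pathPts T (r + s) r s

-- abscissa x_h where the (monotone South/West) path crosses the line y = h - 1/2:
-- the x-coordinate of the first visited point with y ≤ h - 1 (that point is reached
-- by a vertical segment, so it has the same abscissa as the crossing).
xcross : ℕ → List (ℕ × ℕ) → ℕ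
xcross h []             = 0
xcross h ((x , y) ∷ ps) = if y <ᵇ h then x else xcross h ps

-- cell (i , j) is below π(T,k): i ≤ r - 1 and j - 1/2 > x_i  (i.e. x_i < j),
-- where (r , s) is the cell containing k.
belowᵇ : List ℕ → Filling → ℕ → ℕ → ℕ → Bool
belowᵇ sh T k i j = (i <ᵇ proj₁ (cellOf sh T k)) ∧ (xcross i (path sh T k) <ᵇ j)

Below : List ℕ → Filling → ℕ → ℕ → ℕ → Set
Below sh T k i j = belowᵇ sh T k i j ≡ true

sameSideᵇ : List ℕ → Filling → ℕ → ℕ → ℕ → Bool
sameSideᵇ sh T k i j = if belowᵇ sh T k i j then belowᵇ sh T k 1 1
                       else (if belowᵇ sh T k 1 1 then false else true)

sameVal : List ℕ → Filling → ℕ → ℕ → Bool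
sameVal sh T k w with cellOf sh T w
... | (i , j) = sameSideᵇ sh T k i j

scan : List ℕ → Filling → ℕ → ℕ → ℕ → ℕ
scan sh T k zero    w = w
scan sh T k (suc c) w = if sameVal sh T k w then w else scan sh T k c (suc w)

-- for a block start a (< k): the next block start, or k if a's block is the last one;
-- thus the block is a, …, a+m with a+m = nextStart a - 1.
nextStart : List ℕ → Filling → ℕ → ℕ → ℕ
nextStart sh T k a = scan sh T k (k ∸ suc a) (suc a)

-- Ψ_k(T): on cells with content v < k, a block start a becomes a+m, any other
-- content v = a+l (1 ≤ l ≤ m) becomes v-1; contents ≥ k unchanged.
Ψ : List ℕ → Filling → ℕ → Filling
Ψ sh T k i j =
  if T i j <ᵇ k
  then (if sameSideᵇ sh T k i j then nextStart sh T k (T i j) ∸ 1 else T i j ∸ 1)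
  else T i j

{-# OPTIONS --safe #-}
{-
If (1,1) is below π(T,k), then k lies in a row r ≥ 2 and T(1,1) < k lies below the path,
so the last block of cells with content < k starts at the largest a < k whose cell is below
the path.  Ψ_k turns a into k-1 in that cell, which is in a row under r, while k stays in
row r: a descent.

Conversely, at a descent k-1, k of Ψ_k the entry k is untouched and k-1 is the image of a block
start a whose block runs up to k-1, lying in a row i under the row of k.  If (1,1) were above
the path, so would be the cell (i,j) of a, i.e. j ≤ x_i.  The path leaves row i+1 downwards at
abscissa x_i, so (i+1, x_i) is a cell, it is above the path too, and T(i,j) < T(i+1,x_i) < k:
a value on the side of (1,1) inside the block of a, which is impossible.
-}
module Submission where

open import Defs
open import Data.Bool using (Bool; true; false; if_then_else_; _∧_)
open import Data.Bool.Properties using (T-≡; ∧-zeroʳ; ¬-not) renaming (_≟_ to _≟ᵇ_)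
open import Data.List using (List; []; _∷_; applyUpTo)
open import Data.List.Membership.Propositional using (_∈_)
open import Data.List.Membership.Propositional.Properties
  using (∈-applyUpTo⁺; ∈-applyUpTo⁻; ∈-++⁺ˡ; ∈-++⁺ʳ; ∈-++⁻)
open import Data.List.Relation.Unary.All using (_∷_)
open import Data.List.Relation.Unary.Any using (here; there)
open import Data.List.Relation.Unary.Linked using (Linked; []; [-]; _∷_)
open import Data.Nat
  using (ℕ; zero; suc; _+_; _∸_; _≤_; _<_; _≥_; _≤′_; _<ᵇ_; _≡ᵇ_; z≤n; s≤s; s≤s⁻¹; ≤′-refl; ≤′-step)
open import Data.Nat.ListAction using (sum)
open import Data.Nat.Properties
open import Data.Product using (_×_; _,_; ∃-syntax; proj₁; proj₂; uncurry)
open import Data.Sum using (_⊎_; inj₁; inj₂)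
open import Function.Bundles using (_⇔_; mk⇔; Equivalence)
open import Relation.Binary.PropositionalEquality
  using (_≡_; _≢_; refl; sym; trans; cong; subst; module ≡-Reasoning)
open import Relation.Nullary using (yes; no; contradiction)

<ᵇ≡true⇒< : ∀ {m n} → (m <ᵇ n) ≡ true → m < n
<ᵇ≡true⇒< {m} {n} eq = <ᵇ⇒< m n (Equivalence.from T-≡ eq)

<⇒<ᵇ≡true : ∀ {m n} → m < n → (m <ᵇ n) ≡ true
<⇒<ᵇ≡true m<n = Equivalence.to T-≡ (<⇒<ᵇ m<n)

<ᵇ≡false⇒≥ : ∀ {m n} → (m <ᵇ n) ≡ false → n ≤ m
<ᵇ≡false⇒≥ eq = ≮⇒≥ (λ m<n → contradiction (trans (sym eq) (<⇒<ᵇ≡true m<n)) λ ())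

≥⇒<ᵇ≡false : ∀ {m n} → n ≤ m → (m <ᵇ n) ≡ false
≥⇒<ᵇ≡false {m} {n} n≤m with m <ᵇ n in eq
... | false = refl
... | true  = contradiction (<ᵇ≡true⇒< eq) (≤⇒≯ n≤m)

≡ᵇ≡true⇒≡ : ∀ {m n} → (m ≡ᵇ n) ≡ true → m ≡ n
≡ᵇ≡true⇒≡ {m} {n} eq = ≡ᵇ⇒≡ m n (Equivalence.from T-≡ eq)

≡ᵇ-refl : ∀ m → (m ≡ᵇ m) ≡ true
≡ᵇ-refl m = Equivalence.to T-≡ (≡⇒≡ᵇ m m refl)

greatest-true : (g : ℕ → Bool) → ∀ m {w} → w ≤ m → g w ≡ true →
                ∃[ a ] (a ≤ m × g a ≡ true × ∀ {v} → a < v → v ≤ m → g v ≡ false)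
greatest-true g m {w} w≤m gw with g m in gm
... | true = m , ≤-refl , gm , λ m<v v≤m → contradiction v≤m (<⇒≱ m<v)
greatest-true g zero    z≤n gw | false = contradiction (trans (sym gw) gm) λ ()
greatest-true g (suc m) w≤m gw | false with m≤n⇒m<n∨m≡n w≤m
... | inj₂ refl = contradiction (trans (sym gw) gm) λ ()
... | inj₁ w<m+1 =
  let a , a≤m , ga , after = greatest-true g m (s≤s⁻¹ w<m+1) gw
  in a , m≤n⇒m≤1+n a≤m , ga , after′ after
  where
  after′ : ∀ {a} → (∀ {v} → a < v → v ≤ m → g v ≡ false) →
           ∀ {v} → a < v → v ≤ suc m → g v ≡ false
  after′ after a<v v≤m+1 with m≤n⇒m<n∨m≡n v≤m+1
  ... | inj₁ v<m+1 = after a<v (s≤s⁻¹ v<m+1)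
  ... | inj₂ refl  = gm

rowLen-antitone : ∀ {sh} → Linked _≥_ sh → ∀ i → rowLen sh (suc (suc i)) ≤ rowLen sh (suc i)
rowLen-antitone []        _       = z≤n
rowLen-antitone [-]       _       = z≤n
rowLen-antitone (l≥m ∷ _) zero    = l≥m
rowLen-antitone (_ ∷ dec) (suc i) = rowLen-antitone dec i

InShape-down : ∀ {sh i j} → Linked _≥_ sh → InShape sh (suc (suc i)) j → InShape sh (suc i) j
InShape-down {i = i} dec (_ , 1≤j , j≤len) = s≤s z≤n , 1≤j , ≤-trans j≤len (rowLen-antitone dec i)

InShape-left : ∀ {sh i j j′} → InShape sh i j → 1 ≤ j′ → j′ ≤ j → InShape sh i j′
InShape-left (1≤i , _ , j≤len) 1≤j′ j′≤j = 1≤i , 1≤j′ , ≤-trans j′≤j j≤len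

InShape-origin : ∀ {sh i j} → IsPartition sh → InShape sh i j → InShape sh 1 1
InShape-origin {[]}    _             (_ , s≤s _ , ())
InShape-origin {_ ∷ _} (0<l ∷ _ , _) _ = s≤s z≤n , s≤s z≤n , 0<l

module _ {sh : List ℕ} {T : Filling} (syt : IsSYT sh T) where
  open IsSYT syt

  SYT-row-mono : ∀ {i j j′} → InShape sh i j → 1 ≤ j′ → j′ ≤ j → T i j′ ≤ T i j
  SYT-row-mono {i} {j′ = j′} ij 1≤j′ j′≤j = go ij (≤⇒≤′ j′≤j)
    where
    go : ∀ {j} → InShape sh i j → j′ ≤′ j → T i j′ ≤ T i j
    go _  ≤′-refl = ≤-refl
    go ij (≤′-step {j} j′≤j) =
      ≤-trans (go (InShape-left {sh} ij 1≤j (n≤1+n j)) j′≤j) (<⇒≤ (rows i j 1≤j ij))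
      where 1≤j = ≤-trans 1≤j′ (≤′⇒≤ j′≤j)

  SYT-col-mono : Linked _≥_ sh → ∀ {i i′ j} → InShape sh i j → 1 ≤ i′ → i′ ≤ i → T i′ j ≤ T i j
  SYT-col-mono dec {i′ = i′} {j} ij 1≤i′ i′≤i = go ij (≤⇒≤′ i′≤i)
    where
    go : ∀ {i} → InShape sh i j → i′ ≤′ i → T i′ j ≤ T i j
    go _  ≤′-refl = ≤-refl
    go ij (≤′-step {suc i} i′≤i) =
      ≤-trans (go (InShape-down dec ij) i′≤i) (<⇒≤ (cols (suc i) j (s≤s z≤n) ij))
    go ij (≤′-step {zero} i′≤0) = contradiction (≤′⇒≤ i′≤0) (<⇒≱ 1≤i′)

  SYT-mono : Linked _≥_ sh → ∀ {i j i′ j′} → InShape sh i j →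
             1 ≤ i′ → i′ ≤ i → 1 ≤ j′ → j′ ≤ j → T i′ j′ ≤ T i j
  SYT-mono dec ij 1≤i′ i′≤i 1≤j′ j′≤j =
    ≤-trans (SYT-col-mono dec (InShape-left {sh} ij 1≤j′ j′≤j) 1≤i′ i′≤i)
            (SYT-row-mono ij 1≤j′ j′≤j)

∈-cellsFrom⁻ : ∀ i₀ sh {i j} → (i , j) ∈ cellsFrom i₀ sh →
               ∃[ m ] (i ≡ i₀ + m × 1 ≤ j × j ≤ rowLen sh (suc m))
∈-cellsFrom⁻ i₀ (l ∷ ls) c∈ with ∈-++⁻ (applyUpTo (λ j → (i₀ , suc j)) l) c∈
... | inj₁ c∈row with ∈-applyUpTo⁻ (λ j → (i₀ , suc j)) c∈row
...   | _ , j<l , refl = 0 , sym (+-identityʳ i₀) , s≤s z≤n , j<l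
∈-cellsFrom⁻ i₀ (l ∷ ls) c∈ | inj₂ c∈rest with ∈-cellsFrom⁻ (suc i₀) ls c∈rest
... | m , refl , 1≤j , j≤len = suc m , sym (+-suc i₀ m) , 1≤j , j≤len

∈-cellsFrom⁺ : ∀ i₀ sh m {j} → 1 ≤ j → j ≤ rowLen sh (suc m) → (i₀ + m , j) ∈ cellsFrom i₀ sh
∈-cellsFrom⁺ i₀ []       _ (s≤s _) ()
∈-cellsFrom⁺ i₀ (l ∷ ls) zero {suc j} _ j<l rewrite +-identityʳ i₀ =
  ∈-++⁺ˡ (∈-applyUpTo⁺ (λ j → (i₀ , suc j)) j<l)
∈-cellsFrom⁺ i₀ (l ∷ ls) (suc m) 1≤j j≤len rewrite +-suc i₀ m =
  ∈-++⁺ʳ (applyUpTo (λ j → (i₀ , suc j)) l) (∈-cellsFrom⁺ (suc i₀) ls m 1≤j j≤len)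

∈-cells⁻ : ∀ {sh i j} → (i , j) ∈ cells sh → InShape sh i j
∈-cells⁻ {sh} c∈ with ∈-cellsFrom⁻ 1 sh c∈
... | _ , refl , 1≤j , j≤len = s≤s z≤n , 1≤j , j≤len

∈-cells⁺ : ∀ {sh i j} → InShape sh i j → (i , j) ∈ cells sh
∈-cells⁺ {sh} {suc m} (_ , 1≤j , j≤len) = ∈-cellsFrom⁺ 1 sh m 1≤j j≤len

cellOfIn-sound : ∀ T v cs →
                 cellOfIn T v cs ≡ (0 , 0) ⊎ (cellOfIn T v cs ∈ cs × uncurry T (cellOfIn T v cs) ≡ v)
cellOfIn-sound T v []             = inj₁ refl
cellOfIn-sound T v ((i , j) ∷ cs) with T i j ≡ᵇ v in eq
... | true  = inj₂ (here refl , ≡ᵇ≡true⇒≡ eq)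
... | false with cellOfIn-sound T v cs
...   | inj₁ none          = inj₁ none
...   | inj₂ (c∈ , Tc≡v) = inj₂ (there c∈ , Tc≡v)

cellOfIn-unique : ∀ T cs {p q} → (p , q) ∈ cs →
                  (∀ {i j} → (i , j) ∈ cs → T i j ≡ T p q → (i , j) ≡ (p , q)) →
                  cellOfIn T (T p q) cs ≡ (p , q)
cellOfIn-unique T ((i , j) ∷ cs) {p} {q} pq∈ uniq with T i j ≡ᵇ T p q in eq
... | true = uniq (here refl) (≡ᵇ≡true⇒≡ eq)
... | false with pq∈
...   | here refl = contradiction (trans (sym eq) (≡ᵇ-refl (T p q))) λ ()
...   | there pq∈cs = cellOfIn-unique T cs pq∈cs (λ c∈ → uniq (there c∈))

cellOf-sound : ∀ {sh T v r s} → cellOf sh T v ≡ (r , s) →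
               (r , s) ≡ (0 , 0) ⊎ (InShape sh r s × T r s ≡ v)
cellOf-sound {sh} {T} {v} eq with cellOfIn-sound T v (cells sh)
... | inj₁ none          = inj₁ (trans (sym eq) none)
... | inj₂ (c∈ , Tc≡v) rewrite eq = inj₂ (∈-cells⁻ {sh} c∈ , Tc≡v)

cellOf-entry : ∀ {sh T p q} → IsSYT sh T → InShape sh p q → cellOf sh T (T p q) ≡ (p , q)
cellOf-entry {sh} {T} syt pq = cellOfIn-unique T (cells sh) (∈-cells⁺ {sh} pq) uniq
  where
  uniq : ∀ {i j} → (i , j) ∈ cells sh → T i j ≡ T _ _ → (i , j) ≡ (_ , _)
  uniq c∈ Tij≡Tpq with IsSYT.inj syt _ _ _ _ (∈-cells⁻ {sh} c∈) pq Tij≡Tpq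
  ... | refl , refl = refl

crossing : Filling → (f p q h : ℕ) → ℕ
crossing T f p q h = xcross h (pathPts T f p q)

pathPts-head : ∀ T f p q → ∃[ ps ] pathPts T f p q ≡ (q ∸ 1 , p ∸ 1) ∷ ps
pathPts-head T zero    p             q             = _ , refl
pathPts-head T (suc f) zero          q             = _ , refl
pathPts-head T (suc f) (suc zero)    q             = _ , refl
pathPts-head T (suc f) (suc (suc p)) zero          = _ , refl
pathPts-head T (suc f) (suc (suc p)) (suc zero)    = _ , refl
pathPts-head T (suc f) (suc (suc p)) (suc (suc q)) = _ , refl

crossing-start : ∀ T f p q {h} → p ∸ 1 < h → crossing T f p q h ≡ q ∸ 1
crossing-start T f p q p∸1<h with pathPts-head T f p q
... | _ , eq rewrite eq | <⇒<ᵇ≡true p∸1<h = refl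

xcross-last : ∀ {h x y} → 1 ≤ h → h ≤ y → xcross h ((x , y) ∷ (0 , 0) ∷ []) ≡ 0
xcross-last {suc h} _ h≤y rewrite ≥⇒<ᵇ≡false h≤y = refl

module _ {sh : List ℕ} {T : Filling} (syt : IsSYT sh T) (dec : Linked _≥_ sh) where
  open IsSYT syt

  -- The path leaves row h+1 downwards at the lower left-hand corner of the cell (h+1, c+1).
  crossing-cell : ∀ f {p q h} → InShape sh p q → 1 ≤ h → h < p → 1 ≤ crossing T f p q h →
                  let c = crossing T f p q h in
                  InShape sh (suc h) c × T (suc h) c < T p q × c ≤ crossing T f p q (suc h)
  crossing-cell zero {suc p} _ 1≤h (s≤s h≤p) 1≤c = contradiction (xcross-last 1≤h h≤p) (>⇒≢ 1≤c)
  crossing-cell (suc f) {suc zero} _ (s≤s z≤n) (s≤s ()) _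
  crossing-cell (suc f) {suc (suc p)} {zero} _ 1≤h (s≤s h≤p+1) 1≤c =
    contradiction (xcross-last 1≤h h≤p+1) (>⇒≢ 1≤c)
  crossing-cell (suc f) {suc (suc p)} {suc zero} _ 1≤h (s≤s h≤p+1) 1≤c =
    contradiction (xcross-last 1≤h h≤p+1) (>⇒≢ 1≤c)
  crossing-cell (suc f) {suc (suc p)} {suc (suc q)} {h} pq 1≤h (s≤s h≤p+1) 1≤c
    rewrite ≥⇒<ᵇ≡false h≤p+1
    with T (suc (suc p)) (suc q) <ᵇ T (suc p) (suc (suc q)) | m≤n⇒m<n∨m≡n h≤p+1
  ... | true | inj₁ h<p+1 rewrite ≥⇒<ᵇ≡false h<p+1 =
    let inS , lt , le = crossing-cell f (InShape-down dec pq) 1≤h h<p+1 1≤c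
    in inS , <-trans lt (cols (suc p) (suc (suc q)) (s≤s z≤n) pq) , le
  ... | true | inj₂ refl
    rewrite crossing-start T f (suc p) (suc (suc q)) (n<1+n p) | <⇒<ᵇ≡true (n<1+n (suc p)) =
    InShape-left {sh} pq (s≤s z≤n) (n≤1+n _) , rows (suc (suc p)) (suc q) (s≤s z≤n) pq , ≤-refl
  ... | false | h<p+1∨h≡p+1 =
    let inS , lt , le = crossing-cell f (InShape-left {sh} pq (s≤s z≤n) (n≤1+n _)) 1≤h (s≤s h≤p+1) 1≤c
    in inS , <-trans lt (rows (suc (suc p)) (suc q) (s≤s z≤n) pq) , widen h<p+1∨h≡p+1 le
    where
    widen : h < suc p ⊎ h ≡ suc p → ∀ {c} → c ≤ crossing T f (suc (suc p)) (suc q) (suc h) →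
            c ≤ (if suc p <ᵇ suc h then suc q else crossing T f (suc (suc p)) (suc q) (suc h))
    widen (inj₁ h<p+1) le rewrite ≥⇒<ᵇ≡false h<p+1 = le
    widen (inj₂ refl)  le
      rewrite <⇒<ᵇ≡true (n<1+n (suc p)) | crossing-start T f (suc (suc p)) (suc q) (n<1+n (suc p)) =
      m≤n⇒m≤1+n le

module Sides (sh : List ℕ) (T : Filling) (k : ℕ) where
  belowᵇ-cell : ∀ {r s} → cellOf sh T k ≡ (r , s) → ∀ h j →
                belowᵇ sh T k h j ≡ (h <ᵇ r) ∧ (crossing T (r + s) r s h <ᵇ j)
  belowᵇ-cell eq h j rewrite eq = refl

  sameSideᵇ≡true⇔ : ∀ i j → sameSideᵇ sh T k i j ≡ true ⇔ belowᵇ sh T k i j ≡ belowᵇ sh T k 1 1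
  sameSideᵇ≡true⇔ i j with belowᵇ sh T k i j | belowᵇ sh T k 1 1
  ... | true  | true  = mk⇔ (λ _ → refl) (λ _ → refl)
  ... | true  | false = mk⇔ (λ ()) (λ ())
  ... | false | true  = mk⇔ (λ ()) (λ ())
  ... | false | false = mk⇔ (λ _ → refl) (λ _ → refl)

  Below⇒ : ∀ {r s h j} → cellOf sh T k ≡ (r , s) → Below sh T k h j →
           h < r × crossing T (r + s) r s h < j
  Below⇒ {r} {s} {h} {j} eq below
    with h <ᵇ r in h<r | crossing T (r + s) r s h <ᵇ j in x<j | trans (sym (belowᵇ-cell eq h j)) below
  ... | true  | true  | _  = <ᵇ≡true⇒< h<r , <ᵇ≡true⇒< x<j
  ... | true  | false | ()
  ... | false | _     | ()

  ≤crossing⇒¬Below : ∀ {r s h j} → cellOf sh T k ≡ (r , s) → j ≤ crossing T (r + s) r s h →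
                     belowᵇ sh T k h j ≡ false
  ≤crossing⇒¬Below {h = h} {j} eq j≤x rewrite belowᵇ-cell eq h j | ≥⇒<ᵇ≡false j≤x = ∧-zeroʳ _

  ¬Below⇒≤crossing : ∀ {r s h j} → cellOf sh T k ≡ (r , s) → h < r → belowᵇ sh T k h j ≡ false →
                     j ≤ crossing T (r + s) r s h
  ¬Below⇒≤crossing {h = h} {j} eq h<r notBelow
    rewrite belowᵇ-cell eq h j | <⇒<ᵇ≡true h<r = <ᵇ≡false⇒≥ notBelow

  Below⇒col≥1 : ∀ {h j} → Below sh T k h j → 1 ≤ j
  Below⇒col≥1 {j = zero}  below = contradiction (trans (sym below) (∧-zeroʳ _)) λ ()
  Below⇒col≥1 {j = suc j} _     = s≤s z≤n

  sameVal-cell : ∀ {w i j} → cellOf sh T w ≡ (i , j) → sameVal sh T k w ≡ sameSideᵇ sh T k i j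
  sameVal-cell eq rewrite eq = refl

  scan-≥ : ∀ c w → w ≤ scan sh T k c w
  scan-≥ zero    w = ≤-refl
  scan-≥ (suc c) w with sameVal sh T k w
  ... | true  = ≤-refl
  ... | false = <⇒≤ (scan-≥ c (suc w))

  scan-≤ : ∀ c w → scan sh T k c w ≤ w + c
  scan-≤ zero    w = ≤-reflexive (sym (+-identityʳ w))
  scan-≤ (suc c) w with sameVal sh T k w
  ... | true  = m≤m+n w (suc c)
  ... | false = ≤-trans (scan-≤ c (suc w)) (≤-reflexive (sym (+-suc w c)))

  scan-skips : ∀ c {w v} → w ≤ v → v < scan sh T k c w → sameVal sh T k v ≡ false
  scan-skips zero    w≤v v<w = contradiction w≤v (<⇒≱ v<w)
  scan-skips (suc c) {w} w≤v v<scan with sameVal sh T k w in eq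
  ... | true  = contradiction w≤v (<⇒≱ v<scan)
  ... | false with m≤n⇒m<n∨m≡n w≤v
  ...   | inj₁ w<v = scan-skips c w<v v<scan
  ...   | inj₂ refl = eq

  scan-none : ∀ c w → (∀ {v} → w ≤ v → v < w + c → sameVal sh T k v ≡ false) →
              scan sh T k c w ≡ w + c
  scan-none zero    w _    = sym (+-identityʳ w)
  scan-none (suc c) w none rewrite none ≤-refl (m<m+n w (s≤s z≤n)) =
    trans (scan-none c (suc w) λ w<v v<w+c → none (<⇒≤ w<v) (≤-trans v<w+c (≤-reflexive w+c≡)))
          w+c≡
    where w+c≡ = sym (+-suc w c)

  nextStart-> : ∀ a → a < nextStart sh T k a
  nextStart-> a = scan-≥ (k ∸ suc a) (suc a)

  nextStart-≤ : ∀ {a} → a < k → nextStart sh T k a ≤ k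
  nextStart-≤ {a} a<k = ≤-trans (scan-≤ (k ∸ suc a) (suc a)) (≤-reflexive (m+[n∸m]≡n a<k))

  nextStart-skips : ∀ {a v} → a < v → v < nextStart sh T k a → sameVal sh T k v ≡ false
  nextStart-skips {a} = scan-skips (k ∸ suc a)

  nextStart-last : ∀ {a} → a < k → (∀ {v} → a < v → v < k → sameVal sh T k v ≡ false) →
                   nextStart sh T k a ≡ k
  nextStart-last {a} a<k none =
    trans (scan-none (k ∸ suc a) (suc a) λ a<v v<k → none a<v (≤-trans v<k (≤-reflexive k≡))) k≡
    where k≡ = m+[n∸m]≡n a<k

∸1≡⇒≡suc : ∀ {n m} → 1 ≤ n → n ∸ 1 ≡ m → n ≡ suc m
∸1≡⇒≡suc (s≤s _) refl = refl

module ΨProperties (sh : List ℕ) (T : Filling) (κ : ℕ) where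
  open Sides sh T (suc κ)

  Ψ-≥k : ∀ {i j} → suc κ ≤ T i j → Ψ sh T (suc κ) i j ≡ T i j
  Ψ-≥k k≤T rewrite ≥⇒<ᵇ≡false k≤T = refl

  Ψ-block-start : ∀ {i j} → T i j < suc κ → sameSideᵇ sh T (suc κ) i j ≡ true →
                  Ψ sh T (suc κ) i j ≡ nextStart sh T (suc κ) (T i j) ∸ 1
  Ψ-block-start T<k same rewrite <⇒<ᵇ≡true T<k | same = refl

  Ψ-opposite-side : ∀ {i j} → T i j < suc κ → sameSideᵇ sh T (suc κ) i j ≡ false →
                    Ψ sh T (suc κ) i j ≡ T i j ∸ 1
  Ψ-opposite-side T<k other rewrite <⇒<ᵇ≡true T<k | other = refl

  Ψ-<k : ∀ {i j} → T i j < suc κ → Ψ sh T (suc κ) i j < suc κ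
  Ψ-<k {i} {j} T<k rewrite <⇒<ᵇ≡true T<k with sameSideᵇ sh T (suc κ) i j
  ... | true  = s≤s (∸-monoˡ-≤ 1 (nextStart-≤ T<k))
  ... | false = ≤-<-trans (m∸n≤m (T i j) 1) T<k

  Ψ≡k⇒ : ∀ {i j} → Ψ sh T (suc κ) i j ≡ suc κ → T i j ≡ suc κ
  Ψ≡k⇒ {i} {j} Ψ≡k with <-≤-connex (T i j) (suc κ)
  ... | inj₁ T<k = contradiction Ψ≡k (<⇒≢ (Ψ-<k T<k))
  ... | inj₂ k≤T = trans (sym (Ψ-≥k k≤T)) Ψ≡k

  Ψ≡κ⇒ : ∀ {i j} → 1 ≤ T i j → Ψ sh T (suc κ) i j ≡ κ →
         T i j < suc κ × sameSideᵇ sh T (suc κ) i j ≡ true × nextStart sh T (suc κ) (T i j) ≡ suc κ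
  Ψ≡κ⇒ {i} {j} 1≤T Ψ≡κ with <-≤-connex (T i j) (suc κ)
  ... | inj₂ k≤T = contradiction (trans (sym (Ψ-≥k k≤T)) Ψ≡κ) (>⇒≢ k≤T)
  ... | inj₁ T<k with sameSideᵇ sh T (suc κ) i j ≟ᵇ true
  ...   | yes same =
    T<k , same , ∸1≡⇒≡suc (≤-trans (s≤s z≤n) (nextStart-> (T i j))) (trans (sym (Ψ-block-start T<k same)) Ψ≡κ)
  ...   | no other =
    contradiction (∸1≡⇒≡suc 1≤T (trans (sym (Ψ-opposite-side T<k (¬-not other))) Ψ≡κ)) (<⇒≢ T<k)

module _ {sh : List ℕ} (part : IsPartition sh) {T : Filling} (syt : IsSYT sh T) {κ : ℕ} where
  open IsSYT syt
  open Sides sh T (suc κ)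
  open ΨProperties sh T κ

  private
    k = suc κ
    dec = proj₂ part

  sameVal-entry : ∀ {p q} → InShape sh p q → sameVal sh T k (T p q) ≡ sameSideᵇ sh T k p q
  sameVal-entry pq = sameVal-cell (cellOf-entry syt pq)

  -- For a value that is not an entry, cellOf returns (0 , 0), and column 0 is never below the path.
  sameVal⇒Below : Below sh T k 1 1 → ∀ {w} → sameVal sh T k w ≡ true →
                  ∃[ i ] ∃[ j ] (InShape sh i j × T i j ≡ w × Below sh T k i j)
  sameVal⇒Below below₁₁ {w} same = at-cell refl
    where
    Below-cell : ∀ {i j} → cellOf sh T w ≡ (i , j) → Below sh T k i j
    Below-cell {i} {j} cell =
      trans (Equivalence.to (sameSideᵇ≡true⇔ i j) (trans (sym (sameVal-cell cell)) same)) below₁₁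
    at-cell : ∀ {i j} → cellOf sh T w ≡ (i , j) →
              ∃[ i ] ∃[ j ] (InShape sh i j × T i j ≡ w × Below sh T k i j)
    at-cell {i} {j} cell with cellOf-sound {sh} {T} cell | Below-cell cell
    ... | inj₁ refl          | below = contradiction refl (>⇒≢ (Below⇒col≥1 below))
    ... | inj₂ (ij , Tij≡w) | below = i , j , ij , Tij≡w , below

  Below-origin⇒cellₖ : Below sh T k 1 1 →
                       ∃[ r ] ∃[ s ] (cellOf sh T k ≡ (r , s) × InShape sh r s × T r s ≡ k × 1 < r)
  Below-origin⇒cellₖ below₁₁ = at-cell refl
    where
    at-cell : ∀ {r s} → cellOf sh T k ≡ (r , s) →
              ∃[ r ] ∃[ s ] (cellOf sh T k ≡ (r , s) × InShape sh r s × T r s ≡ k × 1 < r)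
    at-cell {r} {s} cell with cellOf-sound {sh} {T} cell | proj₁ (Below⇒ {h = 1} {j = 1} cell below₁₁)
    ... | inj₁ refl          | ()
    ... | inj₂ (rs , Trs≡k) | 1<r = r , s , cell , rs , Trs≡k , 1<r

  Below-origin⇒last-block : Below sh T k 1 1 →
                            ∃[ a ] (a < k × sameVal sh T k a ≡ true × nextStart sh T k a ≡ k)
  Below-origin⇒last-block below₁₁ with Below-origin⇒cellₖ below₁₁
  ... | r , s , _ , rs@(_ , 1≤s , _) , Trs≡k , 1<r =
    let a , a≤κ , same-a , after = greatest-true (sameVal sh T k) κ (s≤s⁻¹ T₁₁<k) same₁₁
    in a , s≤s a≤κ , same-a , nextStart-last (s≤s a≤κ) (λ a<v v<k → after a<v (s≤s⁻¹ v<k))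
    where
    origin = InShape-origin part rs
    T₁₁≢k : T 1 1 ≢ k
    T₁₁≢k T₁₁≡k = <⇒≢ 1<r (proj₁ (inj 1 1 r s origin rs (trans T₁₁≡k (sym Trs≡k))))
    T₁₁<k : T 1 1 < k
    T₁₁<k = ≤∧≢⇒< (subst (T 1 1 ≤_) Trs≡k (SYT-mono syt dec rs (s≤s z≤n) (<⇒≤ 1<r) (s≤s z≤n) 1≤s)) T₁₁≢k
    same₁₁ : sameVal sh T k (T 1 1) ≡ true
    same₁₁ = trans (sameVal-entry origin) (Equivalence.from (sameSideᵇ≡true⇔ 1 1) refl)

  Ψ-last-block-start : ∀ {i j a} → InShape sh i j → T i j ≡ a → a < k → sameVal sh T k a ≡ true →
                       nextStart sh T k a ≡ k → Ψ sh T k i j ≡ κ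
  Ψ-last-block-start {i} {j} ij refl a<k same-a next≡k = begin
    Ψ sh T k i j                 ≡⟨ Ψ-block-start a<k (trans (sym (sameVal-entry ij)) same-a) ⟩
    nextStart sh T k (T i j) ∸ 1 ≡⟨ cong (_∸ 1) next≡k ⟩
    κ                            ∎
    where open ≡-Reasoning

  Below-origin⇒descent : Below sh T k 1 1 → InDes sh (Ψ sh T k) κ
  Below-origin⇒descent below₁₁ =
    let r , s , cellₖ , rs , Trs≡k , _ = Below-origin⇒cellₖ below₁₁
        a , a<k , same-a , next≡k     = Below-origin⇒last-block below₁₁
        i , j , ij , Tij≡a , below-ij = sameVal⇒Below below₁₁ same-a
    in i , j , r , s , ij , rs ,
       Ψ-last-block-start ij Tij≡a a<k same-a next≡k ,
       trans (Ψ-≥k (≤-reflexive (sym Trs≡k))) Trs≡k ,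
       proj₁ (Below⇒ {h = i} {j} cellₖ below-ij)

  ¬Below-origin⇒block-ends-early :
    belowᵇ sh T k 1 1 ≡ false → ∀ {r s i j} → cellOf sh T k ≡ (r , s) → InShape sh r s →
    InShape sh i j → i < r → sameSideᵇ sh T k i j ≡ true →
    ∃[ v ] (T i j < v × v < T r s × sameVal sh T k v ≡ true)
  ¬Below-origin⇒block-ends-early notBelow₁₁ {r} {s} {i} {j} cellₖ rs ij@(1≤i , 1≤j , _) i<r same-ij =
    let c-shape , Tc<Trs , c≤x′ = crossing-cell syt dec (r + s) rs 1≤i i<r (≤-trans 1≤j j≤c)
    in T (suc i) c , Tij<Tc c-shape , Tc<Trs , same-c c-shape c≤x′
    where
    c = crossing T (r + s) r s i
    j≤c : j ≤ c
    j≤c = ¬Below⇒≤crossing cellₖ i<r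
            (trans (Equivalence.to (sameSideᵇ≡true⇔ i j) same-ij) notBelow₁₁)
    Tij<Tc : InShape sh (suc i) c → T i j < T (suc i) c
    Tij<Tc c-shape =
      <-≤-trans (cols i j 1≤i (InShape-left {sh} c-shape 1≤j j≤c)) (SYT-row-mono syt c-shape 1≤j j≤c)
    same-c : InShape sh (suc i) c → c ≤ crossing T (r + s) r s (suc i) → sameVal sh T k (T (suc i) c) ≡ true
    same-c c-shape c≤x′ = trans (sameVal-entry c-shape)
      (Equivalence.from (sameSideᵇ≡true⇔ (suc i) c)
        (trans (≤crossing⇒¬Below cellₖ c≤x′) (sym notBelow₁₁)))

  descent⇒Below-origin : InDes sh (Ψ sh T k) κ → Below sh T k 1 1
  descent⇒Below-origin (i , j , i′ , j′ , ij , ij′ , Ψij≡κ , Ψij′≡k , i<i′)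
    with Ψ≡κ⇒ (proj₁ (range i j ij)) Ψij≡κ
  ... | _ , same-ij , next≡k = ¬-not λ notBelow₁₁ →
    let v , Tij<v , v<k , same-v = ¬Below-origin⇒block-ends-early notBelow₁₁ cellₖ ij′ ij i<i′ same-ij
    in contradiction (trans (sym same-v) (nextStart-skips Tij<v (subst (v <_) k≡next v<k))) λ ()
    where
    Tij′≡k : T i′ j′ ≡ k
    Tij′≡k = Ψ≡k⇒ Ψij′≡k
    cellₖ : cellOf sh T k ≡ (i′ , j′)
    cellₖ = subst (λ v → cellOf sh T v ≡ (i′ , j′)) Tij′≡k (cellOf-entry syt ij′)
    k≡next : T i′ j′ ≡ nextStart sh T k (T i j)
    k≡next = trans Tij′≡k (sym next≡k)

lemma5 : (sh : List ℕ) → IsPartition sh → (T : Filling) → IsSYT sh T →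
         (k : ℕ) → 2 ≤ k → k ≤ sum sh →
         (Below sh T k 1 1 ⇔ InDes sh (Ψ sh T k) (k ∸ 1))
lemma5 sh part T syt (suc κ) (s≤s _) _ =
  mk⇔ (Below-origin⇒descent part syt) (descent⇒Below-origin part syt)
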